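{- Suppose that $1/m \ll 1/k \ll \varepsilon \ll \varepsilon' \ll 1$. Let $G$ be an $\varepsilon$-regular cluster tournament on clusters $V_1, \dots, V_k$, each of size $m$. Let $V'_j \subseteq V_j$ be fixed for each $j \in [k]$. Then for any $i \in [k]$, all but at most $\varepsilon' m$ vertices of $V_i$ have $\sum_{j \in [k] \setminus \{i\}} d_{ij} |V_j'| \pm \varepsilon' km$ outneighbours in $\bigcup_{j \in [k] \setminus \{i\}} V_j'$ and $\sum_{j \in [k] \setminus \{i\}} d_{ji} |V_j'| \pm \varepsilon' km$ inneighbours in $\bigcup_{j \in [k] \setminus \{i\}} V_j'$.
   Context: For disjoint vertex sets $U,V$ of a digraph $G$, $G[U\to V]$ is the bipartite subgraph of edges directed from $U$ to $V$, and its density is $d(G[U\to V]) = e(G[U\to V])/(|U||V|)$. $G[U\to V]$ is $\varepsilon$-regular if for all $U'\subseteq U$, $V'\subseteq V$ with $|U'|>\varepsilon|U|$, $|V'|>\varepsilon|V|$ we have $d(G[U'\to V']) = d(G[U\to V]) \pm \varepsilon$. An oriented graph $G$ on disjoint clusters $V_1,\dots,V_k$ of equal size (vertex set $V_1\cup\dots\cup V_k$) is an $\varepsilon$-regular cluster tournament if $G[V_i]$ is a tournament for each $i$ and $G[V_i\to V_j]$ is $\varepsilon$-regular for all $i\ne j$; $d_{ij}$ denotes the density of $G[V_i\to V_j]$. The notation $a = b \pm c$ means $b-c\le a\le b+c$. Hierarchy notation: $a \ll b$ means that for every $b>0$ there exists $a_0>0$ such that the statement holds for all $0<a\le a_0$;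 hierarchies are read from right to left; $m,k$ are positive integers. -}

module Defs where

open import Data.Nat using (ℕ; zero; suc)
import Data.Nat as ℕ
open import Data.Bool using (Bool; true; false; if_then_else_; _∧_; not)
open import Data.Fin using (Fin; zero; suc; _≟_)
open import Data.Integer using (+_)
open import Data.Rational using (ℚ; _/_; 0ℚ; _+_; _*_; _-_; ∣_∣; _≤_; _<_)
open import Data.Rational.Properties using (_≤?_)
open import Data.Product using (_×_; _,_)
open import Relation.Nullary using (does; ¬_)
open import Relation.Binary.PropositionalEquality using (_≡_)
open import Data.Sum using (_⊎_)

sumℕ : ∀ {n} → (Fin n → ℕ) → ℕ
sumℕ {zero} f = 0
sumℕ {suc n} f = f zero ℕ.+ sumℕ (λ x → f (suc x))

sumℚ : ∀ {n} → (Fin n → ℚ) → ℚ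
sumℚ {zero} f = 0ℚ
sumℚ {suc n} f = f zero + sumℚ (λ x → f (suc x))

count : ∀ {n} → (Fin n → Bool) → ℕ
count f = sumℕ (λ x → if f x then 1 else 0)

ℕ→ℚ : ℕ → ℚ
ℕ→ℚ n = + n / 1

-- a / b as a rational (0 if b = 0; never used with b = 0 in the statement)
frac : ℕ → ℕ → ℚ
frac a zero = 0ℚ
frac a (suc b) = + a / suc b

Subset : ℕ → Set
Subset m = Fin m → Bool

-- Vertex set V_1 ∪ … ∪ V_k: vertex (i , a) is the a-th vertex of cluster V_i
Vertex : ℕ → ℕ → Set
Vertex k m = Fin k × Fin m

Digraph : ℕ → ℕ → Set
Digraph k m = Vertex k m → Vertex k m → Bool

Oriented : ∀ {k m} → Digraph k m → Set
Oriented G = ∀ u v → G u v ≡ true → G v u ≡ false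


edges : ∀ {k m} → Digraph k m → Fin k → Subset m → Fin k → Subset m → ℕ
edges G i U j W = sumℕ (λ a → count (λ b → U a ∧ (W b ∧ G (i , a) (j , b))))

density : ∀ {k m} → Digraph k m → Fin k → Subset m → Fin k → Subset m → ℚ
density G i U j W = frac (edges G i U j W) (count U ℕ.* count W)

full : ∀ {m} → Subset m
full _ = true

d : ∀ {k m} → Digraph k m → Fin k → Fin k → ℚ
d G i j = density G i full j full

_≈_±_ : ℚ → ℚ → ℚ → Set
a ≈ b ± c = ∣ a - b ∣ ≤ c

Regular : ∀ {k m} → ℚ → Digraph k m → Fin k → Fin k → Set
Regular {k} {m} ε G i j =
  ∀ (U W : Subset m) → ε * ℕ→ℚ m < ℕ→ℚ (count U) → ε * ℕ→ℚ m < ℕ→ℚ (count W) →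
  density G i U j W ≈ d G i j ± ε

RegularClusterTournament : ∀ {k m} → ℚ → Digraph k m → Set
RegularClusterTournament {k} {m} ε G =
  Oriented G
  × (∀ (i : Fin k) (a b : Fin m) → ¬ (a ≡ b) → (G (i , a) (i , b) ≡ true) ⊎ (G (i , b) (i , a) ≡ true))
  × (∀ (i j : Fin k) → ¬ (i ≡ j) → Regular ε G i j)

_≢ᵇ_ : ∀ {k} → Fin k → Fin k → Bool
j ≢ᵇ i = not (does (j ≟ i))

outdeg : ∀ {k m} → Digraph k m → (Fin k → Subset m) → Fin k → Fin m → ℕ
outdeg G V' i a = sumℕ (λ j → if j ≢ᵇ i then count (λ b → V' j b ∧ G (i , a) (j , b)) else 0)

indeg : ∀ {k m} → Digraph k m → (Fin k → Subset m) → Fin k → Fin m → ℕ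
indeg G V' i a = sumℕ (λ j → if j ≢ᵇ i then count (λ b → V' j b ∧ G (j , b) (i , a)) else 0)

expOut : ∀ {k m} → Digraph k m → (Fin k → Subset m) → Fin k → ℚ
expOut G V' i = sumℚ (λ j → if j ≢ᵇ i then d G i j * ℕ→ℚ (count (V' j)) else 0ℚ)

expIn : ∀ {k m} → Digraph k m → (Fin k → Subset m) → Fin k → ℚ
expIn G V' i = sumℚ (λ j → if j ≢ᵇ i then d G j i * ℕ→ℚ (count (V' j)) else 0ℚ)

Good : ∀ {k m} → ℚ → Digraph k m → (Fin k → Subset m) → Fin k → Fin m → Bool
Good {k} {m} ε' G V' i a =
  does (∣ ℕ→ℚ (outdeg G V' i a) - expOut G V' i ∣ ≤? ε' * ℕ→ℚ k * ℕ→ℚ m)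
  ∧ does (∣ ℕ→ℚ (indeg G V' i a) - expIn G V' i ∣ ≤? ε' * ℕ→ℚ k * ℕ→ℚ m)

-- Fix a pair (V_i, V_j) and W = V'_j. If more than εm vertices of V_i had more than
-- d_ij |W| + εm outneighbours in W, these vertices and W (when |W| > εm) would span a
-- pair of density above d_ij + ε, contradicting regularity; symmetrically for too few
-- outneighbours, and when |W| ≤ εm every vertex is within εm of d_ij |W| anyway. So each
-- cluster j makes at most 2εm vertices of V_i atypical. A vertex whose outdegree into
-- ⋃_{j ≠ i} V'_j misses Σ_j d_ij |V'_j| by more than ε'km is atypical for more than
-- (ε' - ε)k clusters, so by double counting there are at most 2εm/(ε' - ε) such vertices.
-- Inneighbours are outneighbours in the transposed graph, which is regular with d_ji in
-- place of d_ij. For ε ≤ ε'²/5 the total 4εm/(ε' - ε) is at most ε'm; no lower bounds on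
-- k and m are needed.

module Submission where

open import Defs
open import Data.Nat using (ℕ)
import Data.Nat as ℕ
open import Data.Bool using (not)
open import Data.Fin using (Fin)
open import Data.Product using (Σ; _×_)
open import Data.Rational using (ℚ; 0ℚ; _≤_; _<_; _*_)

open import Algebra.Bundles using (CommutativeMonoid)
import Algebra.Properties.CommutativeSemigroup as CommutativeSemigroup
open import Data.Bool using (Bool; true; false; T; if_then_else_; _∧_)
import Data.Bool.Properties as Bool
open import Data.Fin using (zero; suc; _≟_)
open import Data.Integer as ℤ using (+_)
import Data.Integer.Properties as ℤ
open import Data.Nat using (zero; suc)
import Data.Nat.Properties as ℕ
open import Data.Product using (_,_; proj₁)
open import Data.Rational using (1ℚ; _+_; _-_; -_; ∣_∣; _/_; toℚᵘ; Positive; positive; nonNegative)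
open import Data.Rational.Properties using (_≤?_; _<?_)
import Data.Rational.Properties as ℚ
open import Data.Rational.Solver using (module +-*-Solver)
open import Data.Rational.Unnormalised as ℚᵘ using (mkℚᵘ; *≡*) renaming (_≃_ to _≃ᵘ_)
import Data.Rational.Unnormalised.Properties as ℚᵘ
open import Data.Sum using (_⊎_; inj₁; inj₂; map₂)
open import Function using (_∘_; case_of_)
open import Function.Bundles using (Equivalence)
open import Relation.Binary.PropositionalEquality
open import Relation.Nullary using (¬_; contradiction; Dec; yes; no; does)

open +-*-Solver using (solve; _:+_; _:*_; _:-_; :-_; _:=_; con)

-- Linear arithmetic over ℚ

-[p-q]≡q-p : ∀ p q → - (p - q) ≡ q - p
-[p-q]≡q-p = solve 2 (λ p q → :- (p :- q) := q :- p) refl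

p+[q-p]≡q : ∀ p q → p + (q - p) ≡ q
p+[q-p]≡q = solve 2 (λ p q → p :+ (q :- p) := q) refl

[p+q]-p≡q : ∀ p q → (p + q) - p ≡ q
[p+q]-p≡q = solve 2 (λ p q → (p :+ q) :- p := q) refl

p-[p-q]≡q : ∀ p q → p - (p - q) ≡ q
p-[p-q]≡q = solve 2 (λ p q → p :- (p :- q) := q) refl

p≤q⇒0≤q-p : ∀ {p q} → p ≤ q → 0ℚ ≤ q - p
p≤q⇒0≤q-p {p} {q} p≤q = ℚ.≤-trans (ℚ.≤-reflexive (sym (ℚ.+-inverseʳ p))) (ℚ.+-monoˡ-≤ (- p) p≤q)

0≤q-p⇒p≤q : ∀ {p q} → 0ℚ ≤ q - p → p ≤ q
0≤q-p⇒p≤q {p} {q} 0≤q-p = begin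
  p            ≡⟨ ℚ.+-identityʳ p ⟨
  p + 0ℚ       ≤⟨ ℚ.+-monoʳ-≤ p 0≤q-p ⟩
  p + (q - p)  ≡⟨ p+[q-p]≡q p q ⟩
  q            ∎
  where open ℚ.≤-Reasoning

p<q+r⇒p-q<r : ∀ {p q r} → p < q + r → p - q < r
p<q+r⇒p-q<r {p} {q} {r} p<q+r = begin-strict
  p - q        <⟨ ℚ.+-monoˡ-< (- q) p<q+r ⟩
  (q + r) - q  ≡⟨ [p+q]-p≡q q r ⟩
  r            ∎
  where open ℚ.≤-Reasoning

*-nonNeg : ∀ {p q} → 0ℚ ≤ p → 0ℚ ≤ q → 0ℚ ≤ p * q
*-nonNeg {p} {q} 0≤p 0≤q =
  ℚ.nonNegative⁻¹ (p * q) {{ℚ.nonNeg*nonNeg⇒nonNeg p {{nonNegative 0≤p}} q {{nonNegative 0≤q}}}}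

p≤∣p∣ : ∀ p → p ≤ ∣ p ∣
p≤∣p∣ p with ℚ.∣p∣≡p∨∣p∣≡-p p
... | inj₁ ∣p∣≡p  = ℚ.≤-reflexive (sym ∣p∣≡p)
... | inj₂ ∣p∣≡-p = begin
  p        ≡⟨ ℚ.+-identityʳ p ⟨
  p + 0ℚ   ≤⟨ ℚ.+-monoʳ-≤ p (subst (0ℚ ≤_) ∣p∣≡-p (ℚ.0≤∣p∣ p)) ⟩
  p + - p  ≡⟨ ℚ.+-inverseʳ p ⟩
  0ℚ       ≤⟨ ℚ.0≤∣p∣ p ⟩
  ∣ p ∣    ∎
  where open ℚ.≤-Reasoning

∣p-q∣≡∣q-p∣ : ∀ p q → ∣ p - q ∣ ≡ ∣ q - p ∣
∣p-q∣≡∣q-p∣ p q = trans (sym (ℚ.∣-p∣≡∣p∣ (p - q))) (cong ∣_∣ (-[p-q]≡q-p p q))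

∣p-q∣≤r⇒p≤q+r : ∀ {p q r} → ∣ p - q ∣ ≤ r → p ≤ q + r
∣p-q∣≤r⇒p≤q+r {p} {q} {r} ∣p-q∣≤r = begin
  p            ≡⟨ p+[q-p]≡q q p ⟨
  q + (p - q)  ≤⟨ ℚ.+-monoʳ-≤ q (ℚ.≤-trans (p≤∣p∣ (p - q)) ∣p-q∣≤r) ⟩
  q + r        ∎
  where open ℚ.≤-Reasoning

∣p-q∣≤r⇒q-r≤p : ∀ {p q r} → ∣ p - q ∣ ≤ r → q - r ≤ p
∣p-q∣≤r⇒q-r≤p {p} {q} {r} ∣p-q∣≤r = begin
  q - r        ≤⟨ ℚ.+-monoʳ-≤ q (ℚ.neg-antimono-≤ q-p≤r) ⟩
  q - (q - p)  ≡⟨ p-[p-q]≡q q p ⟩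
  p            ∎
  where
  open ℚ.≤-Reasoning
  q-p≤r : q - p ≤ r
  q-p≤r = ℚ.≤-trans (p≤∣p∣ (q - p)) (subst (_≤ r) (∣p-q∣≡∣q-p∣ p q) ∣p-q∣≤r)

p≤q+r⇒q-r≤p⇒∣p-q∣≤r : ∀ {p q r} → p ≤ q + r → q - r ≤ p → ∣ p - q ∣ ≤ r
p≤q+r⇒q-r≤p⇒∣p-q∣≤r {p} {q} {r} p≤q+r q-r≤p with ℚ.∣p∣≡p∨∣p∣≡-p (p - q)
... | inj₁ ∣p-q∣≡p-q = begin
  ∣ p - q ∣    ≡⟨ ∣p-q∣≡p-q ⟩
  p - q        ≤⟨ ℚ.+-monoˡ-≤ (- q) p≤q+r ⟩
  (q + r) - q  ≡⟨ [p+q]-p≡q q r ⟩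
  r            ∎
  where open ℚ.≤-Reasoning
... | inj₂ ∣p-q∣≡-[p-q] = begin
  ∣ p - q ∣    ≡⟨ trans ∣p-q∣≡-[p-q] (-[p-q]≡q-p p q) ⟩
  q - p        ≤⟨ ℚ.+-monoʳ-≤ q (ℚ.neg-antimono-≤ q-r≤p) ⟩
  q - (q - r)  ≡⟨ p-[p-q]≡q q r ⟩
  r            ∎
  where open ℚ.≤-Reasoning

0≤p≤r⇒0≤q≤r⇒∣p-q∣≤r : ∀ {p q r} → 0ℚ ≤ p → p ≤ r → 0ℚ ≤ q → q ≤ r → ∣ p - q ∣ ≤ r
0≤p≤r⇒0≤q≤r⇒∣p-q∣≤r {p} {q} {r} 0≤p p≤r 0≤q q≤r = p≤q+r⇒q-r≤p⇒∣p-q∣≤r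
  (begin p ≤⟨ p≤r ⟩ r ≡⟨ ℚ.+-identityˡ r ⟨ 0ℚ + r ≤⟨ ℚ.+-monoˡ-≤ r 0≤q ⟩ q + r ∎)
  (begin q - r ≤⟨ ℚ.+-monoˡ-≤ (- r) q≤r ⟩ r - r ≡⟨ ℚ.+-inverseʳ r ⟩ 0ℚ ≤⟨ 0≤p ⟩ p ∎)
  where open ℚ.≤-Reasoning

∣p-q∣≤r⇒∣p*s-q*s∣≤r*s : ∀ {p q r} s → 0ℚ ≤ s → ∣ p - q ∣ ≤ r → ∣ p * s - q * s ∣ ≤ r * s
∣p-q∣≤r⇒∣p*s-q*s∣≤r*s {p} {q} {r} s 0≤s ∣p-q∣≤r = begin
  ∣ p * s - q * s ∣        ≡⟨ cong ∣_∣ ([p-q]*s≡p*s-q*s p q s) ⟨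
  ∣ (p - q) * s ∣          ≡⟨ ℚ.∣p*q∣≡∣p∣*∣q∣ (p - q) s ⟩
  ∣ p - q ∣ * ∣ s ∣        ≡⟨ cong (∣ p - q ∣ *_) (ℚ.0≤p⇒∣p∣≡p 0≤s) ⟩
  ∣ p - q ∣ * s            ≤⟨ ℚ.*-monoʳ-≤-nonNeg s {{nonNegative 0≤s}} ∣p-q∣≤r ⟩
  r * s                    ∎
  where
  open ℚ.≤-Reasoning
  [p-q]*s≡p*s-q*s : ∀ p q s → (p - q) * s ≡ p * s - q * s
  [p-q]*s≡p*s-q*s = solve 3 (λ p q s → (p :- q) :* s := p :* s :- q :* s) refl

T-does : ∀ {A : Set} (a? : Dec A) → T (does a?) → A
T-does (yes a) _ = a

T-not-does : ∀ {A : Set} (a? : Dec A) → T (not (does a?)) → ¬ A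
T-not-does (no ¬a) _ = ¬a

does-⊎ : ∀ {A B C : Set} (a? : Dec A) (b? : Dec B) → (¬ A → ¬ B → C) → ¬ C → T (does a?) ⊎ T (does b?)
does-⊎ (yes _)  _        _      _  = inj₁ _
does-⊎ (no _)   (yes _)  _      _  = inj₂ _
does-⊎ (no ¬a)  (no ¬b)  ¬a¬b⇒c ¬c = contradiction (¬a¬b⇒c ¬a ¬b) ¬c

T-not-∧ : ∀ x y → T (not (x ∧ y)) → T (not x) ⊎ T (not y)
T-not-∧ false y     _ = inj₁ _
T-not-∧ true  false _ = inj₂ _

-- Counts and densities as rationals

toℚᵘ-ℕ→ℚ : ∀ n → toℚᵘ (ℕ→ℚ n) ≃ᵘ mkℚᵘ (+ n) 0
toℚᵘ-ℕ→ℚ n = ℚ.toℚᵘ-fromℚᵘ (mkℚᵘ (+ n) 0)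

ℕ→ℚ-homo-+ : ∀ a b → ℕ→ℚ (a ℕ.+ b) ≡ ℕ→ℚ a + ℕ→ℚ b
ℕ→ℚ-homo-+ a b = ℚ.toℚᵘ-injective (begin
  toℚᵘ (ℕ→ℚ (a ℕ.+ b))                    ≈⟨ toℚᵘ-ℕ→ℚ (a ℕ.+ b) ⟩
  mkℚᵘ (+ (a ℕ.+ b)) 0                    ≈⟨ *≡* (cong (ℤ._* + 1) +-homo) ⟩
  mkℚᵘ (+ a) 0 ℚᵘ.+ mkℚᵘ (+ b) 0          ≈⟨ ℚᵘ.+-cong (toℚᵘ-ℕ→ℚ a) (toℚᵘ-ℕ→ℚ b) ⟨
  toℚᵘ (ℕ→ℚ a) ℚᵘ.+ toℚᵘ (ℕ→ℚ b)          ≈⟨ ℚ.toℚᵘ-homo-+ (ℕ→ℚ a) (ℕ→ℚ b) ⟨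
  toℚᵘ (ℕ→ℚ a + ℕ→ℚ b)                    ∎)
  where
  open ℚᵘ.≃-Reasoning
  +-homo : + (a ℕ.+ b) ≡ + a ℤ.* + 1 ℤ.+ + b ℤ.* + 1
  +-homo = trans (ℤ.pos-+ a b) (sym (cong₂ ℤ._+_ (ℤ.*-identityʳ (+ a)) (ℤ.*-identityʳ (+ b))))

ℕ→ℚ-homo-* : ∀ a b → ℕ→ℚ (a ℕ.* b) ≡ ℕ→ℚ a * ℕ→ℚ b
ℕ→ℚ-homo-* a b = ℚ.toℚᵘ-injective (begin
  toℚᵘ (ℕ→ℚ (a ℕ.* b))                    ≈⟨ toℚᵘ-ℕ→ℚ (a ℕ.* b) ⟩
  mkℚᵘ (+ (a ℕ.* b)) 0                    ≈⟨ *≡* (cong (ℤ._* + 1) (ℤ.pos-* a b)) ⟩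
  mkℚᵘ (+ a) 0 ℚᵘ.* mkℚᵘ (+ b) 0          ≈⟨ ℚᵘ.*-cong (toℚᵘ-ℕ→ℚ a) (toℚᵘ-ℕ→ℚ b) ⟨
  toℚᵘ (ℕ→ℚ a) ℚᵘ.* toℚᵘ (ℕ→ℚ b)          ≈⟨ ℚ.toℚᵘ-homo-* (ℕ→ℚ a) (ℕ→ℚ b) ⟨
  toℚᵘ (ℕ→ℚ a * ℕ→ℚ b)                    ∎)
  where open ℚᵘ.≃-Reasoning

ℕ→ℚ-mono-≤ : ∀ {a b} → a ℕ.≤ b → ℕ→ℚ a ≤ ℕ→ℚ b
ℕ→ℚ-mono-≤ {a} {b} a≤b = ℚ.toℚᵘ-cancel-≤
  (ℚᵘ.≤-respˡ-≃ (ℚᵘ.≃-sym (toℚᵘ-ℕ→ℚ a)) (ℚᵘ.≤-respʳ-≃ (ℚᵘ.≃-sym (toℚᵘ-ℕ→ℚ b))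
    (ℚᵘ.*≤* (ℤ.*-monoʳ-≤-nonNeg (+ 1) (ℤ.+≤+ a≤b)))))

ℕ→ℚ-nonNeg : ∀ n → 0ℚ ≤ ℕ→ℚ n
ℕ→ℚ-nonNeg n = ℕ→ℚ-mono-≤ {0} {n} ℕ.z≤n

ℕ→ℚ-pos : ∀ n → 0ℚ < ℕ→ℚ (suc n)
ℕ→ℚ-pos n = ℚ.<-≤-trans (ℚ.positive⁻¹ 1ℚ) (ℕ→ℚ-mono-≤ {1} {suc n} (ℕ.s≤s ℕ.z≤n))

ℕ→ℚ-pos-Fin : ∀ {n} → Fin n → 0ℚ < ℕ→ℚ n
ℕ→ℚ-pos-Fin {suc n} _ = ℕ→ℚ-pos n

ℕ→ℚ-pos⁻¹ : ∀ {c N} → 0ℚ ≤ N → N < ℕ→ℚ c → 0 ℕ.< c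
ℕ→ℚ-pos⁻¹ {zero}  0≤N N<0 = contradiction (ℚ.≤-<-trans 0≤N N<0) (ℚ.<-irrefl refl)
ℕ→ℚ-pos⁻¹ {suc c} _   _   = ℕ.s≤s ℕ.z≤n

ℕ→ℚ-if : ∀ b n → ℕ→ℚ (if b then n else 0) ≡ (if b then ℕ→ℚ n else 0ℚ)
ℕ→ℚ-if true  n = refl
ℕ→ℚ-if false n = refl

frac-*-cancel : ∀ a {b} → 0 ℕ.< b → frac a b * ℕ→ℚ b ≡ ℕ→ℚ a
frac-*-cancel a {suc b} _ = ℚ.toℚᵘ-injective (begin
  toℚᵘ (frac a (suc b) * ℕ→ℚ (suc b))                 ≈⟨ ℚ.toℚᵘ-homo-* (frac a (suc b)) (ℕ→ℚ (suc b)) ⟩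
  toℚᵘ (frac a (suc b)) ℚᵘ.* toℚᵘ (ℕ→ℚ (suc b))      ≈⟨ ℚᵘ.*-cong (ℚ.toℚᵘ-fromℚᵘ (mkℚᵘ (+ a) b)) (toℚᵘ-ℕ→ℚ (suc b)) ⟩
  mkℚᵘ (+ a) b ℚᵘ.* mkℚᵘ (+ suc b) 0                  ≈⟨ *≡* cross ⟩
  mkℚᵘ (+ a) 0                                        ≈⟨ toℚᵘ-ℕ→ℚ a ⟨
  toℚᵘ (ℕ→ℚ a)                                        ∎)
  where
  open ℚᵘ.≃-Reasoning
  cross : + a ℤ.* + suc b ℤ.* + 1 ≡ + a ℤ.* + suc (b ℕ.* 1)
  cross = trans (ℤ.*-identityʳ _) (cong (λ n → + a ℤ.* + suc n) (sym (ℕ.*-identityʳ b)))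

frac-nonNeg : ∀ a b → 0ℚ ≤ frac a b
frac-nonNeg a zero    = ℚ.≤-refl
frac-nonNeg a (suc b) = ℚ.nonNegative⁻¹ _ {{ℚ.normalize-nonNeg a (suc b)}}

frac-≤-1 : ∀ {a b} → a ℕ.≤ b → frac a b ≤ 1ℚ
frac-≤-1 {a} {zero}  _   = ℚ.nonNegative⁻¹ 1ℚ
frac-≤-1 {a} {suc b} a≤b = ℚ.*-cancelʳ-≤-pos (ℕ→ℚ (suc b)) {{positive (ℕ→ℚ-pos b)}} (begin
  frac a (suc b) * ℕ→ℚ (suc b)  ≡⟨ frac-*-cancel a (ℕ.s≤s ℕ.z≤n) ⟩
  ℕ→ℚ a                         ≤⟨ ℕ→ℚ-mono-≤ a≤b ⟩
  ℕ→ℚ (suc b)                   ≡⟨ ℚ.*-identityˡ (ℕ→ℚ (suc b)) ⟨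
  1ℚ * ℕ→ℚ (suc b)              ∎)
  where open ℚ.≤-Reasoning

∣n-δc∣≤c : ∀ {n c δ} → n ℕ.≤ c → 0ℚ ≤ δ → δ ≤ 1ℚ → ∣ ℕ→ℚ n - δ * ℕ→ℚ c ∣ ≤ ℕ→ℚ c
∣n-δc∣≤c {n} {c} {δ} n≤c 0≤δ δ≤1 = 0≤p≤r⇒0≤q≤r⇒∣p-q∣≤r (ℕ→ℚ-nonNeg n) (ℕ→ℚ-mono-≤ n≤c)
  (*-nonNeg 0≤δ (ℕ→ℚ-nonNeg c))
  (begin
    δ * ℕ→ℚ c    ≤⟨ ℚ.*-monoʳ-≤-nonNeg (ℕ→ℚ c) {{nonNegative (ℕ→ℚ-nonNeg c)}} δ≤1 ⟩
    1ℚ * ℕ→ℚ c   ≡⟨ ℚ.*-identityˡ (ℕ→ℚ c) ⟩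
    ℕ→ℚ c        ∎)
  where open ℚ.≤-Reasoning

-- Finite sums and counting

sumℕ-cong : ∀ {n} {f g : Fin n → ℕ} → (∀ x → f x ≡ g x) → sumℕ f ≡ sumℕ g
sumℕ-cong {zero}  f≗g = refl
sumℕ-cong {suc n} f≗g = cong₂ ℕ._+_ (f≗g zero) (sumℕ-cong (f≗g ∘ suc))

sumℕ-zero : ∀ n → sumℕ {n} (λ _ → 0) ≡ 0
sumℕ-zero zero    = refl
sumℕ-zero (suc n) = sumℕ-zero n

sumℕ-+ : ∀ {n} (f g : Fin n → ℕ) → sumℕ (λ x → f x ℕ.+ g x) ≡ sumℕ f ℕ.+ sumℕ g
sumℕ-+ {zero}  f g = refl
sumℕ-+ {suc n} f g = trans (cong (f zero ℕ.+ g zero ℕ.+_) (sumℕ-+ (f ∘ suc) (g ∘ suc)))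
                           (CommutativeSemigroup.interchange ℕ.+-commutativeSemigroup (f zero) (g zero) _ _)

sumℕ-swap : ∀ {n m} (f : Fin n → Fin m → ℕ) →
            sumℕ (λ x → sumℕ (λ y → f x y)) ≡ sumℕ (λ y → sumℕ (λ x → f x y))
sumℕ-swap {zero}  {m} f = sym (sumℕ-zero m)
sumℕ-swap {suc n}     f = trans (cong (sumℕ (f zero) ℕ.+_) (sumℕ-swap (f ∘ suc)))
                                (sym (sumℕ-+ (f zero) (λ y → sumℕ (λ x → f (suc x) y))))

sumℕ-mono : ∀ {n} {f g : Fin n → ℕ} → (∀ x → f x ℕ.≤ g x) → sumℕ f ℕ.≤ sumℕ g
sumℕ-mono {zero}  f≤g = ℕ.z≤n
sumℕ-mono {suc n} f≤g = ℕ.+-mono-≤ (f≤g zero) (sumℕ-mono (f≤g ∘ suc))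

sumℕ-≤-* : ∀ {n} (f : Fin n → ℕ) {B} → (∀ x → f x ℕ.≤ B) → sumℕ f ℕ.≤ n ℕ.* B
sumℕ-≤-* {zero}  f f≤B = ℕ.z≤n
sumℕ-≤-* {suc n} f f≤B = ℕ.+-mono-≤ (f≤B zero) (sumℕ-≤-* (f ∘ suc) (f≤B ∘ suc))

indicator : Bool → ℕ
indicator b = if b then 1 else 0

count-≤ : ∀ {n} (P : Fin n → Bool) → count P ℕ.≤ n
count-≤ {n} P = ℕ.≤-trans (sumℕ-≤-* _ (indicator-≤-1 ∘ P)) (ℕ.≤-reflexive (ℕ.*-identityʳ n))
  where
  indicator-≤-1 : ∀ b → indicator b ℕ.≤ 1
  indicator-≤-1 true  = ℕ.≤-refl
  indicator-≤-1 false = ℕ.z≤n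

count-true : ∀ n → count {n} (λ _ → true) ≡ n
count-true zero    = refl
count-true (suc n) = cong suc (count-true n)

count-none : ∀ {n} (P : Fin n → Bool) → (∀ x → ¬ T (P x)) → count P ≡ 0
count-none {n} P ¬P = trans (sumℕ-cong (indicator-false ∘ ¬P)) (sumℕ-zero n)
  where
  indicator-false : ∀ {b} → ¬ T b → indicator b ≡ 0
  indicator-false {false} _  = refl
  indicator-false {true}  ¬b = contradiction _ ¬b

count-mono : ∀ {n} (P Q : Fin n → Bool) → (∀ x → T (P x) → T (Q x)) → count P ℕ.≤ count Q
count-mono P Q P⇒Q = sumℕ-mono (λ x → indicator-mono (P x) (Q x) (P⇒Q x))
  where
  indicator-mono : ∀ p q → (T p → T q) → indicator p ℕ.≤ indicator q
  indicator-mono false q     _   = ℕ.z≤n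
  indicator-mono true  true  _   = ℕ.≤-refl
  indicator-mono true  false p⇒q = contradiction (p⇒q _) λ ()

count-⊎ : ∀ {n} (P Q R : Fin n → Bool) → (∀ x → T (P x) → T (Q x) ⊎ T (R x)) →
          count P ℕ.≤ count Q ℕ.+ count R
count-⊎ P Q R P⇒Q⊎R = ℕ.≤-trans (sumℕ-mono (λ x → indicator-⊎ (P x) (Q x) (R x) (P⇒Q⊎R x)))
                                (ℕ.≤-reflexive (sumℕ-+ (indicator ∘ Q) (indicator ∘ R)))
  where
  indicator-⊎ : ∀ p q r → (T p → T q ⊎ T r) → indicator p ℕ.≤ indicator q ℕ.+ indicator r
  indicator-⊎ false q     r     _ = ℕ.z≤n
  indicator-⊎ true  true  r     _ = ℕ.s≤s ℕ.z≤n
  indicator-⊎ true  false true  _ = ℕ.s≤s ℕ.z≤n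
  indicator-⊎ true  false false p⇒q⊎r with p⇒q⊎r _
  ... | inj₁ ()
  ... | inj₂ ()

sumℕ-count-swap : ∀ {n m} (R : Fin n → Fin m → Bool) →
                  sumℕ (λ x → count (R x)) ≡ sumℕ (λ y → count (λ x → R x y))
sumℕ-count-swap R = sumℕ-swap (λ x y → indicator (R x y))

ℕ→ℚ-sumℕ : ∀ {n} (f : Fin n → ℕ) → ℕ→ℚ (sumℕ f) ≡ sumℚ (ℕ→ℚ ∘ f)
ℕ→ℚ-sumℕ {zero}  f = refl
ℕ→ℚ-sumℕ {suc n} f = trans (ℕ→ℚ-homo-+ (f zero) _) (cong (λ s → ℕ→ℚ (f zero) + s) (ℕ→ℚ-sumℕ (f ∘ suc)))

sumℚ-cong : ∀ {n} {f g : Fin n → ℚ} → (∀ x → f x ≡ g x) → sumℚ f ≡ sumℚ g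
sumℚ-cong {zero}  f≗g = refl
sumℚ-cong {suc n} f≗g = cong₂ _+_ (f≗g zero) (sumℚ-cong (f≗g ∘ suc))

sumℚ-+ : ∀ {n} (f g : Fin n → ℚ) → sumℚ (λ x → f x + g x) ≡ sumℚ f + sumℚ g
sumℚ-+ {zero}  f g = sym (ℚ.+-identityˡ 0ℚ)
sumℚ-+ {suc n} f g = trans (cong (λ s → f zero + g zero + s) (sumℚ-+ (f ∘ suc) (g ∘ suc)))
                           (+-interchange (f zero) (g zero) (sumℚ (f ∘ suc)) (sumℚ (g ∘ suc)))
  where
  +-interchange : ∀ a b c d → (a + b) + (c + d) ≡ (a + c) + (b + d)
  +-interchange = solve 4 (λ a b c d → (a :+ b) :+ (c :+ d) := (a :+ c) :+ (b :+ d)) refl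

sumℚ-mono : ∀ {n} {f g : Fin n → ℚ} → (∀ x → f x ≤ g x) → sumℚ f ≤ sumℚ g
sumℚ-mono {zero}  f≤g = ℚ.≤-refl
sumℚ-mono {suc n} f≤g = ℚ.+-mono-≤ (f≤g zero) (sumℚ-mono (f≤g ∘ suc))

∣sumℚ-sumℚ∣≤sumℚ∣-∣ : ∀ {n} (f g : Fin n → ℚ) → ∣ sumℚ f - sumℚ g ∣ ≤ sumℚ (λ x → ∣ f x - g x ∣)
∣sumℚ-sumℚ∣≤sumℚ∣-∣ {zero}  f g = ℚ.≤-refl
∣sumℚ-sumℚ∣≤sumℚ∣-∣ {suc n} f g = begin
  ∣ (f zero + sumℚ (f ∘ suc)) - (g zero + sumℚ (g ∘ suc)) ∣
    ≡⟨ cong ∣_∣ (regroup (f zero) (sumℚ (f ∘ suc)) (g zero) (sumℚ (g ∘ suc))) ⟩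
  ∣ (f zero - g zero) + (sumℚ (f ∘ suc) - sumℚ (g ∘ suc)) ∣
    ≤⟨ ℚ.∣p+q∣≤∣p∣+∣q∣ (f zero - g zero) _ ⟩
  ∣ f zero - g zero ∣ + ∣ sumℚ (f ∘ suc) - sumℚ (g ∘ suc) ∣
    ≤⟨ ℚ.+-monoʳ-≤ ∣ f zero - g zero ∣ (∣sumℚ-sumℚ∣≤sumℚ∣-∣ (f ∘ suc) (g ∘ suc)) ⟩
  ∣ f zero - g zero ∣ + sumℚ (λ x → ∣ f (suc x) - g (suc x) ∣)  ∎
  where
  open ℚ.≤-Reasoning
  regroup : ∀ a b c d → (a + b) - (c + d) ≡ (a - c) + (b - d)
  regroup = solve 4 (λ a b c d → (a :+ b) :- (c :+ d) := (a :- c) :+ (b :- d)) refl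

sumOver : ∀ {n} → (Fin n → Bool) → (Fin n → ℚ) → ℚ
sumOver P f = sumℚ (λ x → if P x then f x else 0ℚ)

sumOver-const : ∀ {n} (P : Fin n → Bool) q → sumOver P (λ _ → q) ≡ ℕ→ℚ (count P) * q
sumOver-const {zero}  P q = sym (ℚ.*-zeroˡ q)
sumOver-const {suc n} P q with P zero
... | true  = begin
  q + sumOver (P ∘ suc) (λ _ → q)             ≡⟨ cong (λ s → q + s) (sumOver-const (P ∘ suc) q) ⟩
  q + ℕ→ℚ (count (P ∘ suc)) * q               ≡⟨ 1+c*q (ℕ→ℚ (count (P ∘ suc))) q ⟩
  (1ℚ + ℕ→ℚ (count (P ∘ suc))) * q            ≡⟨ cong (_* q) (ℕ→ℚ-homo-+ 1 (count (P ∘ suc))) ⟨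
  ℕ→ℚ (suc (count (P ∘ suc))) * q             ∎
  where
  open ≡-Reasoning
  1+c*q : ∀ c q → q + c * q ≡ (1ℚ + c) * q
  1+c*q = solve 2 (λ c q → q :+ c :* q := (con 1ℚ :+ c) :* q) refl
... | false = trans (ℚ.+-identityˡ _) (sumOver-const (P ∘ suc) q)

ℕ→ℚ-sumℕ-if : ∀ {n} (P : Fin n → Bool) (f : Fin n → ℕ) →
              ℕ→ℚ (sumℕ (λ x → if P x then f x else 0)) ≡ sumOver P (ℕ→ℚ ∘ f)
ℕ→ℚ-sumℕ-if P f = trans (ℕ→ℚ-sumℕ (λ x → if P x then f x else 0)) (sumℚ-cong (λ x → ℕ→ℚ-if (P x) (f x)))

sumℚ-const : ∀ n q → sumℚ {n} (λ _ → q) ≡ ℕ→ℚ n * q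
sumℚ-const n q = trans (sumOver-const {n} (λ _ → true) q) (cong (λ c → ℕ→ℚ c * q) (count-true n))

sumℚ-≤-* : ∀ {n} (f : Fin n → ℚ) {B} → (∀ x → f x ≤ B) → sumℚ f ≤ ℕ→ℚ n * B
sumℚ-≤-* {n} f {B} f≤B = ℚ.≤-trans (sumℚ-mono f≤B) (ℚ.≤-reflexive (sumℚ-const n B))

sumOver-mono-≤ : ∀ {n} (P : Fin n → Bool) {f g : Fin n → ℚ} → (∀ x → T (P x) → f x ≤ g x) →
                 sumOver P f ≤ sumOver P g
sumOver-mono-≤ P f≤g = sumℚ-mono λ x → ≤-if (P x) (f≤g x)
  where
  ≤-if : ∀ b {p q} → (T b → p ≤ q) → (if b then p else 0ℚ) ≤ (if b then q else 0ℚ)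
  ≤-if true  p≤q = p≤q _
  ≤-if false _   = ℚ.≤-refl

sumOver-mono-< : ∀ {n} (P : Fin n → Bool) {f g : Fin n → ℚ} → (∀ x → T (P x) → f x < g x) →
                 0 ℕ.< count P → sumOver P f < sumOver P g
sumOver-mono-< {suc n} P {f} {g} f<g 0<|P| with P zero | f<g zero
... | true  | f₀<g₀ = ℚ.+-mono-<-≤ (f₀<g₀ _) (sumOver-mono-≤ (P ∘ suc) (λ x → ℚ.<⇒≤ ∘ f<g (suc x)))
... | false | _     = ℚ.+-monoʳ-< 0ℚ (sumOver-mono-< (P ∘ suc) (f<g ∘ suc) 0<|P|)

count-*-≤-sumℚ : ∀ {n} (P : Fin n → Bool) {t} {f : Fin n → ℚ} →
                 (∀ x → 0ℚ ≤ f x) → (∀ x → T (P x) → t ≤ f x) → ℕ→ℚ (count P) * t ≤ sumℚ f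
count-*-≤-sumℚ P {t} {f} f≥0 P⇒t≤f = begin
  ℕ→ℚ (count P) * t   ≡⟨ sumOver-const P t ⟨
  sumOver P (λ _ → t) ≤⟨ sumℚ-mono (λ x → ≤-f (P x) (f≥0 x) (P⇒t≤f x)) ⟩
  sumℚ f              ∎
  where
  open ℚ.≤-Reasoning
  ≤-f : ∀ b {p} → 0ℚ ≤ p → (T b → t ≤ p) → (if b then t else 0ℚ) ≤ p
  ≤-f true  _   t≤p = t≤p _
  ≤-f false 0≤p _   = 0≤p

count-∧ˡ-≤ : ∀ {n} b (P : Fin n → Bool) {N} → 0ℚ ≤ N → (T b → ℕ→ℚ (count P) ≤ N) →
             ℕ→ℚ (count (λ x → b ∧ P x)) ≤ N
count-∧ˡ-≤ true  P 0≤N |P|≤N = |P|≤N _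
count-∧ˡ-≤ {n} false P 0≤N _ = subst (_≤ _) (cong ℕ→ℚ (sym (count-none {n} (λ _ → false) (λ _ ())))) 0≤N

∣sumOver-sumOver∣≤ : ∀ {n} (P : Fin n → Bool) (f g : Fin n → ℚ) {D B} → 0ℚ ≤ D →
  (∀ x → T (P x) → ∣ f x - g x ∣ ≤ B) →
  ∣ sumOver P f - sumOver P g ∣ ≤ ℕ→ℚ n * D + ℕ→ℚ (count (λ x → P x ∧ not (does (∣ f x - g x ∣ ≤? D)))) * B
∣sumOver-sumOver∣≤ {n} P f g {D} {B} 0≤D P⇒∣f-g∣≤B = begin
  ∣ sumOver P f - sumOver P g ∣
    ≤⟨ ∣sumℚ-sumℚ∣≤sumℚ∣-∣ (λ x → if P x then f x else 0ℚ) (λ x → if P x then g x else 0ℚ) ⟩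
  sumℚ (λ x → ∣ (if P x then f x else 0ℚ) - (if P x then g x else 0ℚ) ∣)
    ≤⟨ sumℚ-mono (λ x → pointwise (P x) (∣ f x - g x ∣ ≤? D) (P⇒∣f-g∣≤B x)) ⟩
  sumℚ (λ x → D + (if far x then B else 0ℚ))
    ≡⟨ sumℚ-+ {n} (λ _ → D) (λ x → if far x then B else 0ℚ) ⟩
  sumℚ {n} (λ _ → D) + sumOver far (λ _ → B)
    ≡⟨ cong₂ _+_ (sumℚ-const n D) (sumOver-const far B) ⟩
  ℕ→ℚ n * D + ℕ→ℚ (count far) * B  ∎
  where
  open ℚ.≤-Reasoning
  far : Fin n → Bool
  far x = P x ∧ not (does (∣ f x - g x ∣ ≤? D))
  pointwise : ∀ {p q} b (near? : Dec (∣ p - q ∣ ≤ D)) → (T b → ∣ p - q ∣ ≤ B) →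
    ∣ (if b then p else 0ℚ) - (if b then q else 0ℚ) ∣ ≤ D + (if b ∧ not (does near?) then B else 0ℚ)
  pointwise false _          _     = ℚ.≤-trans 0≤D (ℚ.≤-reflexive (sym (ℚ.+-identityʳ D)))
  pointwise true  (yes near) _     = ℚ.≤-trans near (ℚ.≤-reflexive (sym (ℚ.+-identityʳ D)))
  pointwise true  (no _)     ∣p-q∣≤B = ℚ.≤-trans (∣p-q∣≤B _) (begin
    B       ≡⟨ ℚ.+-identityˡ B ⟨
    0ℚ + B  ≤⟨ ℚ.+-monoˡ-≤ B 0≤D ⟩
    D + B   ∎)

-- Deviation from averages over large sets

few-above : ∀ {n} (x : Fin n → ℚ) (P : Fin n → Bool) {s N} → 0ℚ ≤ N →
            (∀ U → N < ℕ→ℚ (count U) → sumOver U x ≤ ℕ→ℚ (count U) * s) →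
            (∀ a → T (P a) → s < x a) → ℕ→ℚ (count P) ≤ N
few-above x P {s} 0≤N avg P⇒s<x = ℚ.≮⇒≥ λ N<|P| → ℚ.<-irrefl refl (begin-strict
  sumOver P (λ _ → s)  <⟨ sumOver-mono-< P P⇒s<x (ℕ→ℚ-pos⁻¹ 0≤N N<|P|) ⟩
  sumOver P x          ≤⟨ avg P N<|P| ⟩
  ℕ→ℚ (count P) * s    ≡⟨ sumOver-const P s ⟨
  sumOver P (λ _ → s)  ∎)
  where open ℚ.≤-Reasoning

few-below : ∀ {n} (x : Fin n → ℚ) (P : Fin n → Bool) {s N} → 0ℚ ≤ N →
            (∀ U → N < ℕ→ℚ (count U) → ℕ→ℚ (count U) * s ≤ sumOver U x) →
            (∀ a → T (P a) → x a < s) → ℕ→ℚ (count P) ≤ N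
few-below x P {s} 0≤N avg P⇒x<s = ℚ.≮⇒≥ λ N<|P| → ℚ.<-irrefl refl (begin-strict
  sumOver P x          <⟨ sumOver-mono-< P P⇒x<s (ℕ→ℚ-pos⁻¹ 0≤N N<|P|) ⟩
  sumOver P (λ _ → s)  ≡⟨ sumOver-const P s ⟩
  ℕ→ℚ (count P) * s    ≤⟨ avg P N<|P| ⟩
  sumOver P x          ∎)
  where open ℚ.≤-Reasoning

few-deviating : ∀ {n} (x : Fin n → ℚ) {t D N} → 0ℚ ≤ N →
                (∀ U → N < ℕ→ℚ (count U) →
                   ∣ sumOver U x - ℕ→ℚ (count U) * t ∣ ≤ ℕ→ℚ (count U) * D) →
                ℕ→ℚ (count (λ a → not (does (∣ x a - t ∣ ≤? D)))) ≤ N + N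
few-deviating {n} x {t} {D} {N} 0≤N avg = begin
  ℕ→ℚ (count deviating)                  ≤⟨ ℕ→ℚ-mono-≤ (count-⊎ deviating above below deviating⇒) ⟩
  ℕ→ℚ (count above ℕ.+ count below)      ≡⟨ ℕ→ℚ-homo-+ (count above) (count below) ⟩
  ℕ→ℚ (count above) + ℕ→ℚ (count below)  ≤⟨ ℚ.+-mono-≤ few-above′ few-below′ ⟩
  N + N                                  ∎
  where
  open ℚ.≤-Reasoning
  deviating above below : Fin n → Bool
  deviating a = not (does (∣ x a - t ∣ ≤? D))
  above     a = does (t + D <? x a)
  below     a = does (x a <? t - D)

  deviating⇒ : ∀ a → T (deviating a) → T (above a) ⊎ T (below a)
  deviating⇒ a dev = does-⊎ (t + D <? x a) (x a <? t - D)
    (λ ¬above ¬below → p≤q+r⇒q-r≤p⇒∣p-q∣≤r (ℚ.≮⇒≥ ¬above) (ℚ.≮⇒≥ ¬below))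
    (T-not-does (∣ x a - t ∣ ≤? D) dev)

  p*[q-r]≡p*q-p*r : ∀ p q r → p * (q - r) ≡ p * q - p * r
  p*[q-r]≡p*q-p*r = solve 3 (λ p q r → p :* (q :- r) := p :* q :- p :* r) refl

  few-above′ : ℕ→ℚ (count above) ≤ N
  few-above′ = few-above x above 0≤N
    (λ U N<|U| → subst (sumOver U x ≤_) (sym (ℚ.*-distribˡ-+ (ℕ→ℚ (count U)) t D))
                       (∣p-q∣≤r⇒p≤q+r (avg U N<|U|)))
    (λ a → T-does (t + D <? x a))

  few-below′ : ℕ→ℚ (count below) ≤ N
  few-below′ = few-below x below 0≤N
    (λ U N<|U| → subst (_≤ sumOver U x) (sym (p*[q-r]≡p*q-p*r (ℕ→ℚ (count U)) t D))
                       (∣p-q∣≤r⇒q-r≤p (avg U N<|U|)))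
    (λ a → T-does (x a <? t - D))

-- Regular pairs

transpose : ∀ {k m} → Digraph k m → Digraph k m
transpose G u v = G v u

outdegInto : ∀ {k m} → Digraph k m → Fin k → Fin m → Fin k → Subset m → ℕ
outdegInto G i a j W = count (λ b → W b ∧ G (i , a) (j , b))

module _ {k m} (G : Digraph k m) where

  d-nonNeg : ∀ i j → 0ℚ ≤ d G i j
  d-nonNeg i j = frac-nonNeg (edges G i full j full) (count {m} full ℕ.* count {m} full)

  d-≤-1 : ∀ i j → d G i j ≤ 1ℚ
  d-≤-1 i j = frac-≤-1 {b = count {m} full ℕ.* count {m} full}
    (subst (λ c → edges G i full j full ℕ.≤ c ℕ.* c) (sym (count-true m))
           (sumℕ-≤-* _ (λ a → count-≤ (λ b → G (i , a) (j , b)))))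

  ℕ→ℚ-edges : ∀ i U j W → ℕ→ℚ (edges G i U j W) ≡ sumOver U (λ a → ℕ→ℚ (outdegInto G i a j W))
  ℕ→ℚ-edges i U j W = trans (cong ℕ→ℚ (sumℕ-cong λ a → restrict (U a) a))
                            (ℕ→ℚ-sumℕ-if U (λ a → outdegInto G i a j W))
    where
    restrict : ∀ u a → count (λ b → u ∧ (W b ∧ G (i , a) (j , b))) ≡ (if u then outdegInto G i a j W else 0)
    restrict true  a = refl
    restrict false a = sumℕ-zero m

  edges-transpose : ∀ i U j W → edges (transpose G) i U j W ≡ edges G j W i U
  edges-transpose i U j W = sym (trans
    (sumℕ-swap (λ b a → indicator (W b ∧ (U a ∧ G (j , b) (i , a)))))
    (sumℕ-cong λ a → sumℕ-cong λ b → cong indicator (∧-exchange (W b) (U a) _)))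
    where
    ∧-exchange : ∀ x y z → x ∧ (y ∧ z) ≡ y ∧ (x ∧ z)
    ∧-exchange = CommutativeSemigroup.x∙yz≈y∙xz (CommutativeMonoid.commutativeSemigroup Bool.∧-commutativeMonoid)

  density-transpose : ∀ i U j W → density (transpose G) i U j W ≡ density G j W i U
  density-transpose i U j W = cong₂ frac (edges-transpose i U j W) (ℕ.*-comm (count U) (count W))

  Regular-transpose : ∀ {ε} i j → Regular ε G j i → Regular ε (transpose G) i j
  Regular-transpose i j reg U W εm<|U| εm<|W| =
    subst₂ (λ δ δ′ → δ ≈ δ′ ± _) (sym (density-transpose i U j W)) (sym (density-transpose i full j full))
           (reg W U εm<|W| εm<|U|)

  outdegInto-≤ : ∀ i a j W → outdegInto G i a j W ℕ.≤ count W
  outdegInto-≤ i a j W = count-mono _ W (λ b → proj₁ ∘ Equivalence.to Bool.T-∧)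

  averages-near-density : ∀ {ε} i j (U W : Subset m) → 0ℚ ≤ ε → Regular ε G i j →
    ε * ℕ→ℚ m < ℕ→ℚ (count U) → ε * ℕ→ℚ m < ℕ→ℚ (count W) →
    ∣ sumOver U (λ a → ℕ→ℚ (outdegInto G i a j W)) - ℕ→ℚ (count U) * (d G i j * ℕ→ℚ (count W)) ∣
      ≤ ℕ→ℚ (count U) * (ε * ℕ→ℚ m)
  averages-near-density {ε} i j U W 0≤ε reg εm<|U| εm<|W| = begin
    ∣ sumOver U (λ a → ℕ→ℚ (outdegInto G i a j W)) - u * (d G i j * w) ∣
      ≡⟨ cong₂ (λ p q → ∣ p - q ∣) (trans (sym (ℕ→ℚ-edges i U j W)) (sym (frac-*-cancel (edges G i U j W) 0<uw)))
                                  (trans (u*[δ*w]≡δ*[u*w] u (d G i j) w) (cong (d G i j *_) (sym uw-homo))) ⟩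
    ∣ density G i U j W * ℕ→ℚ uw - d G i j * ℕ→ℚ uw ∣
      ≤⟨ ∣p-q∣≤r⇒∣p*s-q*s∣≤r*s {density G i U j W} {d G i j} {ε} (ℕ→ℚ uw) (ℕ→ℚ-nonNeg uw) (reg U W εm<|U| εm<|W|) ⟩
    ε * ℕ→ℚ uw
      ≡⟨ trans (cong (ε *_) uw-homo) (sym (u*[δ*w]≡δ*[u*w] u ε w)) ⟩
    u * (ε * w)
      ≤⟨ ℚ.*-monoˡ-≤-nonNeg u {{nonNegative (ℕ→ℚ-nonNeg (count U))}}
           (ℚ.*-monoˡ-≤-nonNeg ε {{nonNegative 0≤ε}} (ℕ→ℚ-mono-≤ (count-≤ W))) ⟩
    u * (ε * ℕ→ℚ m)  ∎
    where
    open ℚ.≤-Reasoning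
    u w : ℚ
    u = ℕ→ℚ (count U)
    w = ℕ→ℚ (count W)
    uw : ℕ
    uw = count U ℕ.* count W
    uw-homo : ℕ→ℚ uw ≡ u * w
    uw-homo = ℕ→ℚ-homo-* (count U) (count W)
    0≤εm : 0ℚ ≤ ε * ℕ→ℚ m
    0≤εm = *-nonNeg 0≤ε (ℕ→ℚ-nonNeg m)
    0<uw : 0 ℕ.< uw
    0<uw = ℕ.*-mono-≤ (ℕ→ℚ-pos⁻¹ {count U} 0≤εm εm<|U|) (ℕ→ℚ-pos⁻¹ {count W} 0≤εm εm<|W|)
    u*[δ*w]≡δ*[u*w] : ∀ u δ w → u * (δ * w) ≡ δ * (u * w)
    u*[δ*w]≡δ*[u*w] = solve 3 (λ u δ w → u :* (δ :* w) := δ :* (u :* w)) refl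

  -- When |W| ≤ εm regularity says nothing, but then every vertex is within |W| of d_ij |W|.
  few-atypical-vertices : ∀ {ε} i j (W : Subset m) → 0ℚ ≤ ε → Regular ε G i j →
    ℕ→ℚ (count (λ a → not (does (∣ ℕ→ℚ (outdegInto G i a j W) - d G i j * ℕ→ℚ (count W) ∣ ≤? ε * ℕ→ℚ m))))
      ≤ ε * ℕ→ℚ m + ε * ℕ→ℚ m
  few-atypical-vertices {ε} i j W 0≤ε reg = case ε * ℕ→ℚ m <? ℕ→ℚ (count W) of λ where
      (yes εm<|W|) → few-deviating (λ a → ℕ→ℚ (outdegInto G i a j W)) 0≤εm
                       (λ U εm<|U| → averages-near-density i j U W 0≤ε reg εm<|U| εm<|W|)
      (no εm≮|W|)  → begin
        ℕ→ℚ (count (λ a → not (does (deviation a ≤? ε * ℕ→ℚ m))))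
          ≡⟨ cong ℕ→ℚ (count-none _ λ a atypical →
               T-not-does (deviation a ≤? ε * ℕ→ℚ m) atypical (typical (ℚ.≮⇒≥ εm≮|W|) a)) ⟩
        0ℚ
          ≤⟨ ℚ.+-mono-≤ 0≤εm 0≤εm ⟩
        ε * ℕ→ℚ m + ε * ℕ→ℚ m  ∎
    where
    open ℚ.≤-Reasoning
    0≤εm : 0ℚ ≤ ε * ℕ→ℚ m
    0≤εm = *-nonNeg 0≤ε (ℕ→ℚ-nonNeg m)
    deviation : Fin m → ℚ
    deviation a = ∣ ℕ→ℚ (outdegInto G i a j W) - d G i j * ℕ→ℚ (count W) ∣
    typical : ℕ→ℚ (count W) ≤ ε * ℕ→ℚ m → ∀ a → deviation a ≤ ε * ℕ→ℚ m
    typical |W|≤εm a = ℚ.≤-trans (∣n-δc∣≤c (outdegInto-≤ i a j W) (d-nonNeg i j) (d-≤-1 i j)) |W|≤εm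

-- Degrees into ⋃_{j ≠ i} V'_j

outdegFar : ∀ {k m} → ℚ → Digraph k m → (Fin k → Subset m) → Fin k → Fin m → Bool
outdegFar {k} {m} ε' G V' i a =
  not (does (∣ ℕ→ℚ (outdeg G V' i a) - expOut G V' i ∣ ≤? ε' * ℕ→ℚ k * ℕ→ℚ m))

module _ {k m} (G : Digraph k m) (V' : Fin k → Subset m) (i : Fin k) {ε : ℚ} (0≤ε : 0ℚ ≤ ε)
         (regular : ∀ j → ¬ j ≡ i → Regular ε G i j) where

  private
    εm : ℚ
    εm = ε * ℕ→ℚ m

    0≤εm : 0ℚ ≤ εm
    0≤εm = *-nonNeg 0≤ε (ℕ→ℚ-nonNeg m)

  deviates : Fin k → Fin m → Bool
  deviates j a = not (does (∣ ℕ→ℚ (outdegInto G i a j (V' j)) - d G i j * ℕ→ℚ (count (V' j)) ∣ ≤? εm))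

  atypical : Fin m → Fin k → Bool
  atypical a j = (j ≢ᵇ i) ∧ deviates j a

  outdeg-deviation : ∀ a →
    ∣ ℕ→ℚ (outdeg G V' i a) - expOut G V' i ∣ ≤ ℕ→ℚ k * εm + ℕ→ℚ (count (atypical a)) * ℕ→ℚ m
  outdeg-deviation a =
    subst (λ o → ∣ o - expOut G V' i ∣ ≤ ℕ→ℚ k * εm + ℕ→ℚ (count (atypical a)) * ℕ→ℚ m)
          (sym (ℕ→ℚ-sumℕ-if (_≢ᵇ i) (λ j → outdegInto G i a j (V' j))))
          (∣sumOver-sumOver∣≤ (_≢ᵇ i) _ _ 0≤εm λ j _ →
            ℚ.≤-trans (∣n-δc∣≤c (outdegInto-≤ G i a j (V' j)) (d-nonNeg G i j) (d-≤-1 G i j))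
                      (ℕ→ℚ-mono-≤ (count-≤ (V' j))))

  total-atypicality : sumℚ (λ a → ℕ→ℚ (count (atypical a))) ≤ ℕ→ℚ k * (εm + εm)
  total-atypicality = begin
    sumℚ (λ a → ℕ→ℚ (count (atypical a)))           ≡⟨ ℕ→ℚ-sumℕ (λ a → count (atypical a)) ⟨
    ℕ→ℚ (sumℕ (λ a → count (atypical a)))           ≡⟨ cong ℕ→ℚ (sumℕ-count-swap atypical) ⟩
    ℕ→ℚ (sumℕ (λ j → count (λ a → atypical a j)))   ≡⟨ ℕ→ℚ-sumℕ (λ j → count (λ a → atypical a j)) ⟩
    sumℚ (λ j → ℕ→ℚ (count (λ a → atypical a j)))   ≤⟨ sumℚ-≤-* _ column ⟩
    ℕ→ℚ k * (εm + εm)                               ∎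
    where
    open ℚ.≤-Reasoning
    column : ∀ j → ℕ→ℚ (count (λ a → atypical a j)) ≤ εm + εm
    column j = count-∧ˡ-≤ (j ≢ᵇ i) (deviates j) (ℚ.+-mono-≤ 0≤εm 0≤εm) λ j≢i →
      few-atypical-vertices G i j (V' j) 0≤ε (regular j (T-not-does (j ≟ i) j≢i))

  few-atypical-outdegrees : ∀ ε' → ℕ→ℚ (count (outdegFar ε' G V' i)) * (ε' - ε) ≤ εm + εm
  few-atypical-outdegrees ε' = ℚ.*-cancelʳ-≤-pos (ℕ→ℚ k) {{positive (ℕ→ℚ-pos-Fin i)}} (begin
    ℕ→ℚ (count far) * (ε' - ε) * ℕ→ℚ k     ≡⟨ ℚ.*-assoc (ℕ→ℚ (count far)) (ε' - ε) (ℕ→ℚ k) ⟩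
    ℕ→ℚ (count far) * ((ε' - ε) * ℕ→ℚ k)   ≤⟨ count-*-≤-sumℚ far (λ a → ℕ→ℚ-nonNeg (count (atypical a)))
                                                                 many-atypical ⟩
    sumℚ (λ a → ℕ→ℚ (count (atypical a)))  ≤⟨ total-atypicality ⟩
    ℕ→ℚ k * (εm + εm)                      ≡⟨ ℚ.*-comm (ℕ→ℚ k) (εm + εm) ⟩
    (εm + εm) * ℕ→ℚ k                      ∎)
    where
    open ℚ.≤-Reasoning
    far : Fin m → Bool
    far = outdegFar ε' G V' i
    deviation : Fin m → ℚ
    deviation a = ∣ ℕ→ℚ (outdeg G V' i a) - expOut G V' i ∣
    [ε'-ε]km : ∀ ε' ε k m → (ε' - ε) * k * m ≡ ε' * k * m - k * (ε * m)
    [ε'-ε]km = solve 4 (λ ε' ε k m → (ε' :- ε) :* k :* m := ε' :* k :* m :- k :* (ε :* m)) refl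
    many-atypical : ∀ a → T (far a) → (ε' - ε) * ℕ→ℚ k ≤ ℕ→ℚ (count (atypical a))
    many-atypical a a-far = ℚ.<⇒≤ (ℚ.*-cancelʳ-<-nonNeg (ℕ→ℚ m) {{nonNegative (ℕ→ℚ-nonNeg m)}} (begin-strict
      (ε' - ε) * ℕ→ℚ k * ℕ→ℚ m            ≡⟨ [ε'-ε]km ε' ε (ℕ→ℚ k) (ℕ→ℚ m) ⟩
      ε' * ℕ→ℚ k * ℕ→ℚ m - ℕ→ℚ k * εm     <⟨ p<q+r⇒p-q<r (ℚ.<-≤-trans
                                               (ℚ.≰⇒> (T-not-does (deviation a ≤? ε' * ℕ→ℚ k * ℕ→ℚ m) a-far))
                                               (outdeg-deviation a)) ⟩
      ℕ→ℚ (count (atypical a)) * ℕ→ℚ m    ∎))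

expIn≡expOut-transpose : ∀ {k m} (G : Digraph k m) V' i → expIn G V' i ≡ expOut (transpose G) V' i
expIn≡expOut-transpose G V' i = sumℚ-cong λ j →
  cong (λ δ → if j ≢ᵇ i then δ * ℕ→ℚ (count (V' j)) else 0ℚ) (sym (density-transpose G i full j full))

-- indeg G is outdeg (transpose G) by definition; only expIn needs rewriting.
not-Good⇒outdegFar : ∀ {k m} ε' (G : Digraph k m) V' i a → T (not (Good ε' G V' i a)) →
                     T (outdegFar ε' G V' i a) ⊎ T (outdegFar ε' (transpose G) V' i a)
not-Good⇒outdegFar {k} {m} ε' G V' i a =
  map₂ (subst (λ e → T (not (does (∣ ℕ→ℚ (indeg G V' i a) - e ∣ ≤? threshold)))) (expIn≡expOut-transpose G V' i))
  ∘ T-not-∧ (does (∣ ℕ→ℚ (outdeg G V' i a) - expOut G V' i ∣ ≤? threshold))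
            (does (∣ ℕ→ℚ (indeg G V' i a) - expIn G V' i ∣ ≤? threshold))
  where
  threshold : ℚ
  threshold = ε' * ℕ→ℚ k * ℕ→ℚ m

few-not-Good : ∀ {k m} {ε ε'} (G : Digraph k m) → 0ℚ ≤ ε → 0ℚ < ε' - ε →
  (ε + ε) + (ε + ε) ≤ ε' * (ε' - ε) → (∀ i j → ¬ i ≡ j → Regular ε G i j) →
  ∀ V' i → ℕ→ℚ (count (λ a → not (Good ε' G V' i a))) ≤ ε' * ℕ→ℚ m
few-not-Good {k} {m} {ε} {ε'} G 0≤ε 0<ε'-ε 4ε≤ε'[ε'-ε] regular V' i =
  ℚ.*-cancelʳ-≤-pos (ε' - ε) {{positive 0<ε'-ε}} (begin
    ℕ→ℚ (count (λ a → not (Good ε' G V' i a))) * (ε' - ε)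
      ≤⟨ ℚ.*-monoʳ-≤-nonNeg (ε' - ε) {{nonNegative (ℚ.<⇒≤ 0<ε'-ε)}}
           (ℕ→ℚ-mono-≤ (count-⊎ _ out-far in-far (not-Good⇒outdegFar ε' G V' i))) ⟩
    ℕ→ℚ (count out-far ℕ.+ count in-far) * (ε' - ε)
      ≡⟨ trans (cong (_* (ε' - ε)) (ℕ→ℚ-homo-+ (count out-far) (count in-far)))
               (ℚ.*-distribʳ-+ (ε' - ε) (ℕ→ℚ (count out-far)) (ℕ→ℚ (count in-far))) ⟩
    ℕ→ℚ (count out-far) * (ε' - ε) + ℕ→ℚ (count in-far) * (ε' - ε)
      ≤⟨ ℚ.+-mono-≤ (few-atypical-outdegrees G V' i 0≤ε (λ j j≢i → regular i j (j≢i ∘ sym)) ε')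
                    (few-atypical-outdegrees (transpose G) V' i 0≤ε
                       (λ j j≢i → Regular-transpose G i j (regular j i j≢i)) ε') ⟩
    (ε * ℕ→ℚ m + ε * ℕ→ℚ m) + (ε * ℕ→ℚ m + ε * ℕ→ℚ m)
      ≡⟨ [4ε]m ε (ℕ→ℚ m) ⟩
    ((ε + ε) + (ε + ε)) * ℕ→ℚ m
      ≤⟨ ℚ.*-monoʳ-≤-nonNeg (ℕ→ℚ m) {{nonNegative (ℕ→ℚ-nonNeg m)}} 4ε≤ε'[ε'-ε] ⟩
    ε' * (ε' - ε) * ℕ→ℚ m
      ≡⟨ ε'[ε'-ε]m ε' ε (ℕ→ℚ m) ⟩
    ε' * ℕ→ℚ m * (ε' - ε)  ∎)
  where
  open ℚ.≤-Reasoning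
  out-far in-far : Fin m → Bool
  out-far = outdegFar ε' G V' i
  in-far  = outdegFar ε' (transpose G) V' i
  [4ε]m : ∀ ε m → (ε * m + ε * m) + (ε * m + ε * m) ≡ ((ε + ε) + (ε + ε)) * m
  [4ε]m = solve 2 (λ ε m → (ε :* m :+ ε :* m) :+ (ε :* m :+ ε :* m) := ((ε :+ ε) :+ (ε :+ ε)) :* m) refl
  ε'[ε'-ε]m : ∀ ε' ε m → ε' * (ε' - ε) * m ≡ ε' * m * (ε' - ε)
  ε'[ε'-ε]m = solve 3 (λ ε' ε m → ε' :* (ε' :- ε) :* m := ε' :* m :* (ε' :- ε)) refl

ε₀ : ℚ → ℚ
ε₀ ε' = ε' * ε' * (+ 1 / 5)

-- ε' - ε and ε'(ε' - ε) - 4ε are written as sums of manifestly nonnegative terms.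
ε≤ε₀-suffices : ∀ {ε ε'} → 0ℚ < ε' → ε' ≤ 1ℚ → 0ℚ ≤ ε → ε ≤ ε₀ ε' →
                0ℚ < ε' - ε × (ε + ε) + (ε + ε) ≤ ε' * (ε' - ε)
ε≤ε₀-suffices {ε} {ε'} 0<ε' ε'≤1 0≤ε ε≤ε₀ =
  subst (0ℚ <_) (sym (gap ε ε'))
    (ℚ.+-mono-<-≤ (ℚ.*-monoʳ-<-pos (+ 4 / 5) 0<ε')
                  (ℚ.+-mono-≤ (*-nonNeg (*-nonNeg 0≤ε' 0≤1-ε') (ℚ.nonNegative⁻¹ (+ 1 / 5))) 0≤ε₀-ε)) ,
  0≤q-p⇒p≤q (subst (0ℚ ≤_) (sym (surplus ε ε'))
    (ℚ.+-mono-≤ (*-nonNeg 0≤ε₀-ε (ℚ.nonNegative⁻¹ (+ 5 / 1))) (*-nonNeg 0≤ε 0≤1-ε')))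
  where
  0≤ε' : 0ℚ ≤ ε'
  0≤ε' = ℚ.<⇒≤ 0<ε'
  0≤1-ε' : 0ℚ ≤ 1ℚ - ε'
  0≤1-ε' = p≤q⇒0≤q-p ε'≤1
  0≤ε₀-ε : 0ℚ ≤ ε₀ ε' - ε
  0≤ε₀-ε = p≤q⇒0≤q-p ε≤ε₀
  gap : ∀ ε ε' → ε' - ε ≡ + 4 / 5 * ε' + (ε' * (1ℚ - ε') * (+ 1 / 5) + (ε₀ ε' - ε))
  gap = solve 2 (λ ε ε' → ε' :- ε
                      := con (+ 4 / 5) :* ε' :+ (ε' :* (con 1ℚ :- ε') :* con (+ 1 / 5)
                                                :+ (ε' :* ε' :* con (+ 1 / 5) :- ε))) refl
  surplus : ∀ ε ε' → ε' * (ε' - ε) - ((ε + ε) + (ε + ε)) ≡ (ε₀ ε' - ε) * (+ 5 / 1) + ε * (1ℚ - ε')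
  surplus = solve 2 (λ ε ε' → ε' :* (ε' :- ε) :- ((ε :+ ε) :+ (ε :+ ε))
                          := (ε' :* ε' :* con (+ 1 / 5) :- ε) :* con (+ 5 / 1) :+ ε :* (con 1ℚ :- ε')) refl

lemma4p3 : Σ ℚ λ ε'₀ → (0ℚ < ε'₀) ×
    (∀ (ε' : ℚ) → 0ℚ < ε' → ε' ≤ ε'₀ →
      Σ ℚ λ ε₀ → (0ℚ < ε₀) ×
      (∀ (ε : ℚ) → 0ℚ < ε → ε ≤ ε₀ →
        Σ ℕ λ k₀ → ∀ (k : ℕ) → k₀ ℕ.≤ k →
        Σ ℕ λ m₀ → ∀ (m : ℕ) → m₀ ℕ.≤ m →
        ∀ (G : Digraph k m) → RegularClusterTournament ε G →
        ∀ (V' : Fin k → Subset m) (i : Fin k) →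
        ℕ→ℚ (count (λ a → not (Good ε' G V' i a))) ≤ ε' * ℕ→ℚ m))
lemma4p3 = 1ℚ , ℚ.positive⁻¹ 1ℚ , λ ε' 0<ε' ε'≤1 →
  ε₀ ε' , ℚ.positive⁻¹ (ε₀ ε') {{ε₀-pos ε' 0<ε'}} , λ ε 0<ε ε≤ε₀ →
  0 , λ k _ → 0 , λ m _ G (_ , _ , regular) →
    let 0≤ε = ℚ.<⇒≤ 0<ε
        0<ε'-ε , 4ε≤ε'[ε'-ε] = ε≤ε₀-suffices 0<ε' ε'≤1 0≤ε ε≤ε₀
    in few-not-Good {ε = ε} {ε' = ε'} G 0≤ε 0<ε'-ε 4ε≤ε'[ε'-ε] regular
  where
  ε₀-pos : ∀ ε' → 0ℚ < ε' → Positive (ε₀ ε')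
  ε₀-pos ε' 0<ε' = ℚ.pos*pos⇒pos (ε' * ε') {{ℚ.pos*pos⇒pos ε' {{positive 0<ε'}} ε' {{positive 0<ε'}}}} (+ 1 / 5)
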